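{- Let $r\ge 3$ and let $T$ be a forest with $k+1$ vertices and maximum degree $\Delta$. Then for every $n$, $\mathrm{schex}_r(n,\mathcal{B}(T))\le k+(r-3)(k-1)+\Delta-1$, i.e., every $r$-uniform hypergraph containing no Berge copy of $T$ has strong chromatic number at most $k+(r-3)(k-1)+\Delta-1$.
   Context: For a graph $T$, a hypergraph $\mathcal{H}$ is a Berge-$T$ if there is a bijection $f:E(T)\to E(\mathcal{H})$ with $e\subseteq f(e)$ for every $e\in E(T)$; $\mathcal{B}(T)$ is the family of all Berge-$T$ hypergraphs, and a hypergraph is $\mathcal{B}(T)$-free if it contains no subhypergraph belonging to $\mathcal{B}(T)$. $\mathrm{schex}_r(n,\mathcal{B}(T))$ is the supremum of $\chi_s(\mathcal{H})$ over $\mathcal{B}(T)$-free $r$-uniform hypergraphs on $n$ vertices, where $\chi_s$ (strong chromatic number) is the minimum number of colors in a vertex coloring in which every hyperedge is rainbow. -}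

module Defs where

open import Data.Nat using (ℕ; zero; suc; _+_; _*_; _∸_; _≤_; _<_)
open import Data.Bool using (Bool; true; false)
open import Data.Fin using (Fin; inject₁; fromℕ) renaming (zero to fzero; suc to fsuc; _<_ to _<ᶠ_)
open import Data.Fin.Subset using (Subset; _∈_; ∣_∣)
open import Data.Vec using (tabulate)
open import Data.List using (List; length; lookup)
open import Data.List.Relation.Unary.All using (All)
open import Data.List.Relation.Unary.Unique.Propositional using (Unique)
open import Data.Product using (Σ; ∃; _×_; _,_)
open import Relation.Binary.PropositionalEquality using (_≡_)
open import Relation.Nullary using (¬_)
open import Function.Definitions using (Injective)

record Graph (N : ℕ) : Set where
  field
    adj   : Fin N → Fin N → Bool
    irrefl : ∀ u → adj u u ≡ false
    sym   : ∀ u v → adj u v ≡ adj v u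
open Graph public

degree : ∀ {N} → Graph N → Fin N → ℕ
degree G u = ∣ tabulate (adj G u) ∣

MaxDegree : ∀ {N} → Graph N → ℕ → Set
MaxDegree G Δ = (∀ u → degree G u ≤ Δ) × (∃ λ u → degree G u ≡ Δ)

-- a cycle of length L+1 (L ≥ 2): distinct vertices p 0, …, p L,
-- consecutive ones adjacent and p L adjacent to p 0
record Cycle {N : ℕ} (G : Graph N) : Set where
  field
    L      : ℕ
    long   : 2 ≤ L
    p      : Fin (suc L) → Fin N
    inj    : Injective _≡_ _≡_ p
    step   : ∀ (i : Fin L) → adj G (p (inject₁ i)) (p (fsuc i)) ≡ true
    close  : adj G (p (fromℕ L)) (p fzero) ≡ true

IsForest : ∀ {N} → Graph N → Set
IsForest G = ¬ Cycle G

record UniformHypergraph (r n : ℕ) : Set where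
  field
    edges   : List (Subset n)
    uniform : All (λ e → ∣ e ∣ ≡ r) edges
    simple  : Unique edges
open UniformHypergraph public

HEdge : ∀ {r n} → UniformHypergraph r n → Set
HEdge H = Fin (length (edges H))

hedge : ∀ {r n} (H : UniformHypergraph r n) → HEdge H → Subset n
hedge H i = lookup (edges H) i

record BergeCopy {N r n : ℕ} (G : Graph N) (H : UniformHypergraph r n) : Set where
  field
    φ     : Fin N → Fin n
    φ-inj : Injective _≡_ _≡_ φ
    ψ     : (u v : Fin N) → u <ᶠ v → adj G u v ≡ true → HEdge H
    ψ-inj : ∀ {u v u' v'} (l : u <ᶠ v) (a : adj G u v ≡ true)
              (l' : u' <ᶠ v') (a' : adj G u' v' ≡ true) →
              ψ u v l a ≡ ψ u' v' l' a' → (u ≡ u') × (v ≡ v')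
    sub   : ∀ u v (l : u <ᶠ v) (a : adj G u v ≡ true) →
              (φ u ∈ hedge H (ψ u v l a)) × (φ v ∈ hedge H (ψ u v l a))

BergeFree : ∀ {N r n} → Graph N → UniformHypergraph r n → Set
BergeFree G H = ¬ BergeCopy G H

StrongColouring : ∀ {r n} → UniformHypergraph r n → (m : ℕ) → (Fin n → Fin m) → Set
StrongColouring H m c =
  ∀ (i : HEdge H) x y → x ∈ hedge H i → y ∈ hedge H i → c x ≡ c y → x ≡ y

StrongChromatic≤ : ∀ {r n} → UniformHypergraph r n → ℕ → Set
StrongChromatic≤ H m = Σ (Fin _ → Fin m) (StrongColouring H m)

{-# OPTIONS --safe #-}
module Submission where

-- A colouring is strong exactly when it properly colours the 2-shadow of H, the graph joining
-- two vertices that lie in a common hyperedge.  Colouring the shadow greedily with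
-- m = k + (r − 3)(k − 1) + Δ − 1 colours fails only if some nonempty vertex set S induces
-- minimum degree at least m, and then H contains a Berge copy of T, built inside S one leaf at
-- a time (every nonempty vertex set of a forest has a vertex with at most one neighbour in it).
-- To attach a leaf v to its embedded neighbour u when j vertices are embedded, pick a shadow
-- neighbour w of φ(u) in S, through a hyperedge e, with w new and e unused.  This rules out the
-- j − 1 other images and, in each of the at most j − 1 used hyperedges through φ(u), the r − 3
-- vertices besides φ(u) and the ends of its tree edge, plus one more for each of the at most
-- Δ − 1 used tree edges at u: fewer than m of the at least m candidates.

open import Data.Bool using (Bool; true; false; _∧_; _∨_; not; if_then_else_)
open import Data.Bool.Properties
  using (∧-zeroʳ; ∧-identityʳ; ∧-conicalˡ; ∧-conicalʳ; ∨-conicalˡ; ∨-conicalʳ) renaming (_≟_ to _≟ᵇ_)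
open import Data.Fin using (Fin; zero; suc; toℕ; inject₁; fromℕ; _≟_) renaming (_<_ to _<ᶠ_)
open import Data.Fin.Properties
  using (toℕ-injective; toℕ<n; toℕ-inject₁; toℕ-fromℕ; pigeonhole; any?) renaming (<-asym to <ᶠ-asym)
open import Data.Fin.Subset using (Subset; ∣_∣; _∈_)
open import Data.Fin.Subset.Properties using (_∈?_)
open import Data.List.Membership.Propositional.Properties using (∈-lookup)
import Data.List.Relation.Unary.All as All
open import Data.Maybe using (Maybe; just; nothing; is-just)
open import Data.Maybe.Properties using (just-injective)
open import Data.Nat using (ℕ; zero; suc; _+_; _*_; _∸_; _≤_; _<_; _≤?_; _<?_; z≤n; s≤s)
open import Data.Nat.Induction using (<-rec)
open import Data.Nat.Properties hiding (_≟_)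
open import Algebra.Properties.Semiring.Sum +-*-semiring
  using (sum; ∑-comm; ∑-distrib-+; *-distribʳ-sum; sum-cong-≗)
open import Algebra.Properties.CommutativeSemigroup +-commutativeSemigroup using (x∙yz≈y∙xz)
open import Data.Product using (∃; _×_; _,_; proj₁; proj₂; swap)
open import Data.Product.Properties using (,-injective)
open import Data.Sum using (_⊎_; inj₁; inj₂)
open import Data.Vec using ([]; _∷_; lookup; tabulate)
open import Data.Vec.Properties using ([]=⇒lookup; lookup∘tabulate)
open import Data.Vec.Functional using (updateAt)
open import Data.Vec.Functional.Properties using (updateAt-updates; updateAt-minimal; map-updateAt)
open import Function using (_∘_; mk⇔)
open import Relation.Binary.Definitions using (tri<; tri≈; tri>)
open import Relation.Binary.PropositionalEquality
open import Relation.Nullary using (Dec; yes; no; does; contradiction)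
open import Relation.Nullary.Decidable using (_×-dec_; ¬?; dec-true; dec-false; does-⇔)

open import Defs renaming (sym to adj-sym)

private variable n k : ℕ

∑-mono-≤ : {f g : Fin n → ℕ} → (∀ i → f i ≤ g i) → sum f ≤ sum g
∑-mono-≤ {zero}  f≤g = z≤n
∑-mono-≤ {suc n} f≤g = +-mono-≤ (f≤g zero) (∑-mono-≤ (f≤g ∘ suc))

∑<∑⇒∃< : (f g : Fin n → ℕ) → sum f < sum g → ∃ λ i → f i < g i
∑<∑⇒∃< {suc n} f g ∑f<∑g with f zero <? g zero | sum (f ∘ suc) <? sum (g ∘ suc)
... | yes f₀<g₀ | _       = zero , f₀<g₀
... | no _      | yes ∑<∑ = let i , fᵢ<gᵢ = ∑<∑⇒∃< (f ∘ suc) (g ∘ suc) ∑<∑ in suc i , fᵢ<gᵢ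
... | no f₀≮g₀  | no ∑≮∑  = contradiction ∑f<∑g (≤⇒≯ (+-mono-≤ (≮⇒≥ f₀≮g₀) (≮⇒≥ ∑≮∑)))

∑≡0⇒≡0 : (f : Fin n → ℕ) → sum f ≡ 0 → ∀ i → f i ≡ 0
∑≡0⇒≡0 f ∑≡0 zero    = m+n≡0⇒m≡0 _ ∑≡0
∑≡0⇒≡0 f ∑≡0 (suc i) = ∑≡0⇒≡0 (f ∘ suc) (m+n≡0⇒n≡0 (f zero) ∑≡0) i

⟦_⟧ : Bool → ℕ
⟦ b ⟧ = if b then 1 else 0

infixl 6 _-_
_-_ : (Fin n → Bool) → Fin n → Fin n → Bool
(p - y) x = p x ∧ not (does (x ≟ y))

x∈p-y⁺ : {p : Fin n → Bool} {x y : Fin n} → p x ≡ true → x ≢ y → (p - y) x ≡ true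
x∈p-y⁺ {x = x} {y} pₓ x≢y with x ≟ y
... | yes x≡y = contradiction x≡y x≢y
... | no  _   = cong (_∧ true) pₓ

x∈p-y⁻ : {p : Fin n → Bool} {x y : Fin n} → (p - y) x ≡ true → p x ≡ true × x ≢ y
x∈p-y⁻ {p = p} {x} {y} q with x ≟ y
... | yes _ with () ← trans (sym (∧-zeroʳ (p x))) q
... | no  x≢y = trans (sym (∧-identityʳ (p x))) q , x≢y

-- Opaque, so that count p ≤ count q determines p and q during unification.
opaque
  count : (Fin n → Bool) → ℕ
  count p = sum (λ x → ⟦ p x ⟧)

  count≡∑ : (p : Fin n → Bool) → count p ≡ sum (λ x → ⟦ p x ⟧)
  count≡∑ p = refl

  count-mono : {p q : Fin n → Bool} → (∀ x → p x ≡ true → q x ≡ true) → count p ≤ count q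
  count-mono {p = p} {q} p⊆q = ∑-mono-≤ λ x → ⟦⟧-mono (p x) (q x) (p⊆q x)
    where
    ⟦⟧-mono : ∀ a b → (a ≡ true → b ≡ true) → ⟦ a ⟧ ≤ ⟦ b ⟧
    ⟦⟧-mono false b _   = z≤n
    ⟦⟧-mono true  b a⇒b rewrite a⇒b refl = ≤-refl

  count-cong : {p q : Fin n → Bool} → (∀ x → p x ≡ q x) → count p ≡ count q
  count-cong p≗q = sum-cong-≗ (cong ⟦_⟧ ∘ p≗q)

  count-≤-+ : {p q q′ : Fin n → Bool} → (∀ x → ⟦ p x ⟧ ≤ ⟦ q x ⟧ + ⟦ q′ x ⟧) → count p ≤ count q + count q′
  count-≤-+ {q = q} {q′} p≤q+q′ =
    ≤-trans (∑-mono-≤ p≤q+q′) (≤-reflexive (∑-distrib-+ (λ x → ⟦ q x ⟧) (λ x → ⟦ q′ x ⟧)))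

  count-true : ∀ n → count {n} (λ _ → true) ≡ n
  count-true zero    = refl
  count-true (suc n) = cong suc (count-true n)

  count-false : ∀ n → count {n} (λ _ → false) ≡ 0
  count-false zero    = refl
  count-false (suc n) = count-false n

  count-≟ : (y : Fin n) → count (λ x → does (x ≟ y)) ≡ 1
  count-≟ {suc n} zero    = cong suc (count-false n)
  count-≟ {suc n} (suc y) = count-≟ y

  count-remove : (p : Fin n → Bool) (y : Fin n) → p y ≡ true → count p ≡ suc (count (p - y))
  count-remove {suc n} p zero    p₀ rewrite p₀ =
    cong suc (sum-cong-≗ λ x → cong ⟦_⟧ (sym (∧-identityʳ (p (suc x)))))
  count-remove {suc n} p (suc y) pᵧ with p zero | count-remove (p ∘ suc) y pᵧ
  ... | true  | eq = cong suc eq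
  ... | false | eq = eq

  count-updateAt : (p : Fin n → Bool) (y : Fin n) (b : Bool) → p y ≡ false →
                   count (updateAt p y (λ _ → b)) ≡ ⟦ b ⟧ + count p
  count-updateAt p zero    b p₀ rewrite p₀ = refl
  count-updateAt p (suc y) b pᵧ =
    trans (cong (⟦ p zero ⟧ +_) (count-updateAt (p ∘ suc) y b pᵧ)) (x∙yz≈y∙xz ⟦ p zero ⟧ ⟦ b ⟧ _)

  ∣p∣≡count : (p : Subset n) → ∣ p ∣ ≡ count (lookup p)
  ∣p∣≡count []          = refl
  ∣p∣≡count (true ∷ p)  = cong suc (∣p∣≡count p)
  ∣p∣≡count (false ∷ p) = ∣p∣≡count p

  -- Counting the pairs (a, x) with x ∈ B a in two ways.
  pigeonhole-∑ : (p : Fin n → Bool) (B : Fin k → Fin n → Bool) → sum (λ a → count (B a)) < count p →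
                 ∃ λ x → p x ≡ true × ∀ a → B a x ≡ false
  pigeonhole-∑ p B ∑B<p
    with x , ∑Bₓ<pₓ ← ∑<∑⇒∃< (λ x → sum (λ a → ⟦ B a x ⟧)) (λ x → ⟦ p x ⟧)
                              (subst (_< count p) (∑-comm (λ a x → ⟦ B a x ⟧)) ∑B<p)
    with p x in pₓ
  ... | true = x , pₓ , λ a → ⟦⟧≡0 (∑≡0⇒≡0 (λ a → ⟦ B a x ⟧) (n<1⇒n≡0 ∑Bₓ<pₓ) a)
    where
    ⟦⟧≡0 : ∀ {b} → ⟦ b ⟧ ≡ 0 → b ≡ false
    ⟦⟧≡0 {false} _ = refl

count-∨ : (p q : Fin n → Bool) → count (λ x → p x ∨ q x) ≤ count p + count q
count-∨ p q = count-≤-+ λ x → ⟦∨⟧≤ (p x) (q x)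
  where
  ⟦∨⟧≤ : ∀ a b → ⟦ a ∨ b ⟧ ≤ ⟦ a ⟧ + ⟦ b ⟧
  ⟦∨⟧≤ true  b = s≤s z≤n
  ⟦∨⟧≤ false b = ≤-refl

count-singleton : (b : Bool) (y : Fin n) → count (λ x → b ∧ does (x ≟ y)) ≡ ⟦ b ⟧
count-singleton     true  y = count-≟ y
count-singleton {n} false y = count-false n

count-image : (p : Fin k → Bool) (f : Fin k → Fin n) →
              sum (λ a → count (λ x → p a ∧ does (x ≟ f a))) ≡ count p
count-image p f = trans (sum-cong-≗ λ a → count-singleton (p a) (f a)) (sym (count≡∑ p))

count≤n : (p : Fin n → Bool) → count p ≤ n
count≤n {n} p = subst (count p ≤_) (count-true n) (count-mono λ _ _ → refl)

count-remove-∸ : (p : Fin n → Bool) (y : Fin n) → p y ≡ true → count (p - y) ≡ count p ∸ 1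
count-remove-∸ p y pᵧ = cong (_∸ 1) (sym (count-remove p y pᵧ))

count-remove-≤ : (p : Fin n → Bool) (y : Fin n) → count (p - y) ≤ count p
count-remove-≤ p y = count-mono λ x → proj₁ ∘ x∈p-y⁻ {p = p}

x∈p⇒0<count : (p : Fin n → Bool) {x : Fin n} → p x ≡ true → 0 < count p
x∈p⇒0<count p {x} pₓ = subst (0 <_) (sym (count-remove p x pₓ)) (s≤s z≤n)

count≡0⇒x∉p : (p : Fin n → Bool) → count p ≡ 0 → ∀ x → p x ≡ false
count≡0⇒x∉p p count≡0 x with p x in pₓ
... | true  = contradiction (trans (sym count≡0) (count-remove p x pₓ)) 0≢1+n
... | false = refl

0<count⇒∃ : (p : Fin n → Bool) → 0 < count p → ∃ λ x → p x ≡ true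
0<count⇒∃ p 0<p with x , pₓ , _ ← pigeonhole-∑ {k = 0} p (λ ()) 0<p = x , pₓ

2≤count : (p : Fin n → Bool) {x y : Fin n} → p x ≡ true → p y ≡ true → x ≢ y → 2 ≤ count p
2≤count p {x} {y} pₓ pᵧ x≢y
  rewrite count-remove p x pₓ | count-remove (p - x) y (x∈p-y⁺ {p = p} pᵧ (x≢y ∘ sym)) = s≤s (s≤s z≤n)

pigeonhole-image : (q : Fin n → Bool) (p : Fin k → Bool) (f : Fin k → Fin n) → count p < count q →
                   ∃ λ x → q x ≡ true × ∀ a → p a ≡ true → f a ≢ x
pigeonhole-image q p f p<q
  with x , qₓ , unhit ← pigeonhole-∑ q (λ a x → p a ∧ does (x ≟ f a)) (subst (_< count q) (sym (count-image p f)) p<q)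
  = x , qₓ , λ a pₐ fₐ≡x → does≡false⇒≢ (subst (λ b → b ∧ does (x ≟ f a) ≡ false) pₐ (unhit a)) (sym fₐ≡x)
  where
  does≡false⇒≢ : ∀ {x y} → does (x ≟ y) ≡ false → x ≢ y
  does≡false⇒≢ {x} {y} eq with x ≟ y
  ... | no x≢y = x≢y

adj⇒≢ : (G : Graph n) {x y : Fin n} → adj G x y ≡ true → x ≢ y
adj⇒≢ G {x} x-y refl with () ← trans (sym x-y) (irrefl G x)

degree≡count : (G : Graph n) (u : Fin n) → degree G u ≡ count (adj G u)
degree≡count G u = trans (∣p∣≡count (tabulate (adj G u))) (count-cong (lookup∘tabulate (adj G u)))

InducedMinDegree : Graph n → (Fin n → Bool) → ℕ → Set
InducedMinDegree G S d = ∀ x → S x ≡ true → d ≤ count (λ y → S y ∧ adj G x y)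

LeafIn : Graph n → (Fin n → Bool) → Fin n → Set
LeafIn G A v = ∀ {b c} → A b ≡ true → A c ≡ true → adj G v b ≡ true → adj G v c ≡ true → b ≡ c

module NonBacktrackingWalk (G : Graph n) (w : ℕ → Fin n)
         (walk : ∀ t → adj G (w t) (w (suc t)) ≡ true)
         (nonBacktracking : ∀ t → w (suc (suc t)) ≢ w t) where

  InjectiveBelow : ℕ → Set
  InjectiveBelow j = ∀ a b → a < j → b < j → w a ≡ w b → a ≡ b

  Revisits : ℕ → Set
  Revisits j = ∃ λ i → i < j × w i ≡ w j

  first-revisit : ∀ j → Revisits j → ∃ λ j → Revisits j × InjectiveBelow j
  first-revisit = <-rec (λ j → Revisits j → ∃ λ j → Revisits j × InjectiveBelow j) go
    where
    go : ∀ j → (∀ {b} → b < j → Revisits b → ∃ λ j → Revisits j × InjectiveBelow j) →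
         Revisits j → ∃ λ j → Revisits j × InjectiveBelow j
    go j earlier revisit with anyUpTo? (λ b → anyUpTo? (λ i → w i ≟ w b) b) j
    ... | yes (b , b<j , revisit-b) = earlier b<j revisit-b
    ... | no none = j , revisit , injective
      where
      injective : InjectiveBelow j
      injective a b a<j b<j eq with <-cmp a b
      ... | tri< a<b _ _ = contradiction (b , b<j , a , a<b , eq) none
      ... | tri≈ _ a≡b _ = a≡b
      ... | tri> _ _ b<a = contradiction (a , a<j , b , b<a , sym eq) none

  closedSegment⇒cycle : ∀ i L → 2 ≤ L → w (suc (i + L)) ≡ w i → InjectiveBelow (suc (i + L)) → Cycle G
  closedSegment⇒cycle i L 2≤L closes injective = record
    { L = L ; long = 2≤L ; p = p ; inj = p-injective ; step = step ; close = close }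
    where
    p : Fin (suc L) → Fin n
    p t = w (i + toℕ t)
    below : ∀ t → i + toℕ t < suc (i + L)
    below t = s≤s (+-monoʳ-≤ i (≤-pred (toℕ<n t)))
    p-injective : ∀ {s t} → p s ≡ p t → s ≡ t
    p-injective {s} {t} eq = toℕ-injective (+-cancelˡ-≡ i _ _ (injective _ _ (below s) (below t) eq))
    step : ∀ t → adj G (p (inject₁ t)) (p (suc t)) ≡ true
    step t rewrite toℕ-inject₁ t | +-suc i (toℕ t) = walk (i + toℕ t)
    close : adj G (p (fromℕ L)) (p zero) ≡ true
    close rewrite toℕ-fromℕ L | +-identityʳ i | sym closes = walk (i + L)

  -- Revisiting after one or two steps is excluded by irreflexivity and by non-backtracking.
  closedWalk⇒cycle : ∀ i d → w (suc (i + d)) ≡ w i → InjectiveBelow (suc (i + d)) → Cycle G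
  closedWalk⇒cycle i 0 closes _ =
    contradiction (sym closes) (adj⇒≢ G (subst (λ j → adj G (w i) (w (suc j)) ≡ true) (sym (+-identityʳ i)) (walk i)))
  closedWalk⇒cycle i 1 closes _ =
    contradiction (subst (λ j → w j ≡ w i) (cong suc (+-comm i 1)) closes) (nonBacktracking i)
  closedWalk⇒cycle i (suc (suc L)) = closedSegment⇒cycle i (suc (suc L)) (s≤s (s≤s z≤n))

  cycle : Cycle G
  cycle =
    let i , j , i<j , wᵢ≡wⱼ            = pigeonhole (n<1+n n) (w ∘ toℕ)
        j′ , (i′ , i′<j′ , eq) , injective = first-revisit (toℕ j) (toℕ i , i<j , wᵢ≡wⱼ)
        d , i′+1+d≡j′                    = m≤n⇒∃[o]m+o≡n i′<j′
    in closedWalk⇒cycle i′ d (subst (λ j → w j ≡ w i′) (sym i′+1+d≡j′) (sym eq))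
                              (subst InjectiveBelow (sym i′+1+d≡j′) injective)

module _ (G : Graph n) (A : Fin n → Bool) (minDegree : InducedMinDegree G A 2) where

  record Arc : Set where
    constructor arc
    field
      tail head : Fin n
      head∈A    : A head ≡ true
      adjacent  : adj G tail head ≡ true
  open Arc

  onward : (p c : Fin n) → A c ≡ true → ∃ λ b → A b ≡ true × adj G c b ≡ true × p ≢ b
  onward p c A-c
    with b , A∩N-b , p≢b ← pigeonhole-image (λ b → A b ∧ adj G c b) (λ _ → true) (λ (_ : Fin 1) → p)
                             (subst (_< count (λ b → A b ∧ adj G c b)) (sym (count-true 1)) (minDegree c A-c))
    = b , ∧-conicalˡ _ _ A∩N-b , ∧-conicalʳ (A b) _ A∩N-b , p≢b zero refl

  nextArc : Arc → Arc
  nextArc a = let b , A-b , head-b , _ = onward (tail a) (head a) (head∈A a) in arc (head a) b A-b head-b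

  nextArc-nonBacktracking : ∀ a → tail a ≢ head (nextArc a)
  nextArc-nonBacktracking a = let _ , _ , _ , tail≢b = onward (tail a) (head a) (head∈A a) in tail≢b

  minDegree2⇒cycle : ∃ (λ a → A a ≡ true) → Cycle G
  minDegree2⇒cycle (a₀ , A-a₀) =
    NonBacktrackingWalk.cycle G (tail ∘ arcs) (adjacent ∘ arcs) (λ t → nextArc-nonBacktracking (arcs t) ∘ sym)
    where
    arcs : ℕ → Arc
    arcs zero    = let b , A-b , a₀-b , _ = onward a₀ a₀ A-a₀ in arc a₀ b A-b a₀-b
    arcs (suc t) = nextArc (arcs t)

forest-leaf : (G : Graph n) → IsForest G → (A : Fin n → Bool) → ∃ (λ a → A a ≡ true) →
              ∃ λ v → A v ≡ true × LeafIn G A v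
forest-leaf G acyclic A nonempty with any? (λ v → (A v ≟ᵇ true) ×-dec (count (λ b → A b ∧ adj G v b) ≤? 1))
... | yes (v , A-v , degree≤1) = v , A-v , unique
  where
  unique : LeafIn G A v
  unique {b} {c} A-b A-c v-b v-c with b ≟ c
  ... | yes b≡c = b≡c
  ... | no  b≢c = contradiction (2≤count (λ b → A b ∧ adj G v b) (cong₂ _∧_ A-b v-b) (cong₂ _∧_ A-c v-c) b≢c)
                                (<⇒≱ (s≤s degree≤1))
... | no noLeaf = contradiction (minDegree2⇒cycle G A minDegree nonempty) acyclic
  where
  minDegree : InducedMinDegree G A 2
  minDegree v A-v with count (λ b → A b ∧ adj G v b) ≤? 1
  ... | yes degree≤1 = contradiction (v , A-v , degree≤1) noLeaf
  ... | no  degree≰1 = ≰⇒> degree≰1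

ProperColouring : Graph n → (m : ℕ) → (Fin n → Fin m) → Set
ProperColouring G m c = ∀ x y → adj G x y ≡ true → c x ≢ c y

DenseSubgraph : Graph n → ℕ → Set
DenseSubgraph G d = ∃ λ S → ∃ (λ x → S x ≡ true) × InducedMinDegree G S d

module _ (G : Graph n) (m : ℕ) where

  ProperOn : (Fin n → Bool) → (Fin n → Fin (suc m)) → Set
  ProperOn S c = ∀ x y → S x ≡ true → S y ≡ true → adj G x y ≡ true → c x ≢ c y

  extendColouring : (S : Fin n → Bool) (x : Fin n) → count (λ y → S y ∧ adj G x y) < suc m →
                    (c : Fin n → Fin (suc m)) → ProperOn (S - x) c → ∃ (ProperOn S)
  extendColouring S x lowDegree c proper
    with col , _ , unused ← pigeonhole-image (λ _ → true) (λ y → S y ∧ adj G x y) c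
                              (subst (count (λ y → S y ∧ adj G x y) <_) (sym (count-true (suc m))) lowDegree)
    = c′ , proper′
    where
    c′ = updateAt c x (λ _ → col)
    recoloured : c′ x ≡ col
    recoloured = updateAt-updates x c
    unchanged : ∀ {y} → y ≢ x → c′ y ≡ c y
    unchanged y≢x = updateAt-minimal _ x c y≢x
    fresh : ∀ {y} → S y ≡ true → adj G x y ≡ true → col ≢ c y
    fresh S-y x-y = unused _ (cong₂ _∧_ S-y x-y) ∘ sym
    proper′ : ProperOn S c′
    proper′ y z S-y S-z y-z with y ≟ x | z ≟ x
    ... | yes refl | yes refl = contradiction refl (adj⇒≢ G y-z)
    ... | yes refl | no z≢x   = subst₂ _≢_ (sym recoloured) (sym (unchanged z≢x)) (fresh S-z y-z)
    ... | no y≢x   | yes refl = subst₂ _≢_ (sym (unchanged y≢x)) (sym recoloured)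
                                  (fresh S-y (trans (adj-sym G z y) y-z) ∘ sym)
    ... | no y≢x   | no z≢x   = subst₂ _≢_ (sym (unchanged y≢x)) (sym (unchanged z≢x))
                                  (proper y z (x∈p-y⁺ {p = S} S-y y≢x) (x∈p-y⁺ {p = S} S-z z≢x) y-z)

  dense-or-colourableOn : ∀ j S → count S ≡ j → DenseSubgraph G (suc m) ⊎ ∃ (ProperOn S)
  dense-or-colourableOn zero S empty =
    inj₂ ((λ _ → zero) , λ x _ S-x → contradiction (trans (sym S-x) (count≡0⇒x∉p S empty x)) λ ())
  dense-or-colourableOn (suc j) S size
    with any? (λ x → (S x ≟ᵇ true) ×-dec (count (λ y → S y ∧ adj G x y) <? suc m))
  ... | no noLowDegree = inj₁ (S , 0<count⇒∃ S (subst (0 <_) (sym size) (s≤s z≤n)) ,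
                               λ x S-x → ≮⇒≥ λ lowDegree → noLowDegree (x , S-x , lowDegree))
  ... | yes (x , S-x , lowDegree)
    with dense-or-colourableOn j (S - x) (trans (count-remove-∸ S x S-x) (cong (_∸ 1) size))
  ...   | inj₁ dense        = inj₁ dense
  ...   | inj₂ (c , proper) = inj₂ (extendColouring S x lowDegree c proper)

dense-or-colourable : (G : Graph n) (m : ℕ) → DenseSubgraph G m ⊎ ∃ (ProperColouring G m)
dense-or-colourable {zero}  G zero    = inj₂ ((λ ()) , λ ())
dense-or-colourable {suc n} G zero    = inj₁ ((λ _ → true) , (zero , refl) , λ _ _ → z≤n)
dense-or-colourable {n}     G (suc m) with dense-or-colourableOn G m n (λ _ → true) (count-true n)
... | inj₁ dense        = inj₁ dense
... | inj₂ (c , proper) = inj₂ (c , λ x y → proper x y refl refl)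

module _ {r n : ℕ} (H : UniformHypergraph r n) where

  Shadow : Fin n → Fin n → Set
  Shadow x y = x ≢ y × ∃ λ i → x ∈ hedge H i × y ∈ hedge H i

  shadow? : ∀ x y → Dec (Shadow x y)
  shadow? x y = ¬? (x ≟ y) ×-dec any? (λ i → (x ∈? hedge H i) ×-dec (y ∈? hedge H i))

  Shadow-sym : ∀ {x y} → Shadow x y → Shadow y x
  Shadow-sym (x≢y , i , x∈i , y∈i) = x≢y ∘ sym , i , y∈i , x∈i

  shadow : Graph n
  shadow = record
    { adj    = λ x y → does (shadow? x y)
    ; irrefl = λ x → dec-false (shadow? x x) λ (x≢x , _) → x≢x refl
    ; sym    = λ x y → does-⇔ (mk⇔ Shadow-sym Shadow-sym) (shadow? x y) (shadow? y x)
    }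

  adj⇒Shadow : ∀ {x y} → adj shadow x y ≡ true → Shadow x y
  adj⇒Shadow {x} {y} = witness (shadow? x y)
    where
    witness : ∀ {P : Set} (p? : Dec P) → does p? ≡ true → P
    witness (yes p) _ = p

  properColouring⇒strong : ∀ {m c} → ProperColouring shadow m c → StrongColouring H m c
  properColouring⇒strong proper i x y x∈i y∈i cx≡cy with x ≟ y
  ... | yes x≡y = x≡y
  ... | no  x≢y = contradiction cx≡cy (proper x y (dec-true (shadow? x y) (x≢y , i , x∈i , y∈i)))

r∸1∸1≤ : ∀ r → r ∸ 1 ∸ 1 ≤ 1 * (r ∸ 3) + 1
r∸1∸1≤ 0 = z≤n
r∸1∸1≤ 1 = z≤n
r∸1∸1≤ 2 = z≤n
r∸1∸1≤ (suc (suc (suc r))) = ≤-reflexive (trans (+-comm 1 r) (cong (_+ 1) (sym (+-identityʳ r))))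

r∸1∸1∸1≤ : ∀ r → r ∸ 1 ∸ 1 ∸ 1 ≤ 1 * (r ∸ 3) + 0
r∸1∸1∸1≤ 0 = z≤n
r∸1∸1∸1≤ 1 = z≤n
r∸1∸1∸1≤ 2 = z≤n
r∸1∸1∸1≤ (suc (suc (suc r))) = ≤-reflexive (sym (trans (+-identityʳ _) (+-identityʳ r)))

module PartialCopies {r n k : ℕ} (T : Graph (suc k)) (H : UniformHypergraph r n) (S : Fin n → Bool) where

  Link : Set
  Link = Maybe (Fin (suc k) × HEdge H)

  -- link a ≡ just (b , i): a is a child of b and the hyperedge i represents the tree edge ab.
  -- Orienting every edge towards a parent represents it exactly once, and #links≤ is the
  -- forest bound |E| ≤ |A| − 1.
  record PartialCopy (A : Fin (suc k) → Bool) : Set where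
    field
      φ                   : Fin (suc k) → Fin n
      φ-injective         : ∀ {a b} → A a ≡ true → A b ≡ true → φ a ≡ φ b → a ≡ b
      φ∈S                 : ∀ {a} → A a ≡ true → S (φ a) ≡ true
      link                : Fin (suc k) → Link
      link⇒∈A             : ∀ {a b i} → link a ≡ just (b , i) → A a ≡ true
      parent∈A            : ∀ {a b i} → link a ≡ just (b , i) → A b ≡ true
      parent-adj          : ∀ {a b i} → link a ≡ just (b , i) → adj T a b ≡ true
      no-mutual-parents   : ∀ {a b i j} → link a ≡ just (b , i) → link b ≢ just (a , j)
      adj⇒linked          : ∀ {a b} → A a ≡ true → A b ≡ true → adj T a b ≡ true →
                            (∃ λ i → link a ≡ just (b , i)) ⊎ (∃ λ i → link b ≡ just (a , i))
      hyperedge-injective : ∀ {a a′ b b′ i} → link a ≡ just (b , i) → link a′ ≡ just (b′ , i) → a ≡ a′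
      hyperedge-contains  : ∀ {a b i} → link a ≡ just (b , i) → φ a ∈ hedge H i × φ b ∈ hedge H i
      #links≤             : count (is-just ∘ link) ≤ count A ∸ 1

  emptyCopy : (A : Fin (suc k) → Bool) → count A ≡ 0 → Fin n → PartialCopy A
  emptyCopy A empty x = record
    { φ = λ _ → x ; φ-injective = λ A-a → absurd A-a ; φ∈S = absurd
    ; link = λ _ → nothing
    ; link⇒∈A = λ () ; parent∈A = λ () ; parent-adj = λ () ; no-mutual-parents = λ ()
    ; adj⇒linked = λ A-a → absurd A-a ; hyperedge-injective = λ () ; hyperedge-contains = λ ()
    ; #links≤ = subst (_≤ count A ∸ 1) (sym (count-false (suc k))) z≤n }
    where
    absurd : ∀ {a} {X : Set} → A a ≡ true → X
    absurd {a} A-a = contradiction (trans (sym A-a) (count≡0⇒x∉p A empty a)) λ ()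

  toBergeCopy : PartialCopy (λ _ → true) → BergeCopy T H
  toBergeCopy C = record
    { φ     = φ
    ; φ-inj = φ-injective refl refl
    ; ψ     = λ a b _ a-b → edgeOf (adj⇒linked refl refl a-b)
    ; ψ-inj = λ a<b a-b a′<b′ a′-b′ → edgeOf-injective a<b a′<b′ (adj⇒linked refl refl a-b) (adj⇒linked refl refl a′-b′)
    ; sub   = λ a b _ a-b → edgeOf-contains (adj⇒linked refl refl a-b)
    }
    where
    open PartialCopy C
    Linked : Fin (suc k) → Fin (suc k) → Set
    Linked a b = (∃ λ i → link a ≡ just (b , i)) ⊎ (∃ λ i → link b ≡ just (a , i))

    edgeOf : ∀ {a b} → Linked a b → HEdge H
    edgeOf (inj₁ (i , _)) = i
    edgeOf (inj₂ (i , _)) = i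

    edgeOf-contains : ∀ {a b} (ab : Linked a b) → φ a ∈ hedge H (edgeOf ab) × φ b ∈ hedge H (edgeOf ab)
    edgeOf-contains (inj₁ (i , a→b)) = hyperedge-contains a→b
    edgeOf-contains (inj₂ (i , b→a)) = swap (hyperedge-contains b→a)

    same-parent : ∀ {a a′ b b′ i} → link a ≡ just (b , i) → link a′ ≡ just (b′ , i) → a ≡ a′ × b ≡ b′
    same-parent a→b a′→b′ with refl ← hyperedge-injective a→b a′→b′ =
      refl , proj₁ (,-injective (just-injective (trans (sym a→b) a′→b′)))

    edgeOf-injective : ∀ {a b a′ b′} → a <ᶠ b → a′ <ᶠ b′ → (ab : Linked a b) (a′b′ : Linked a′ b′) →
                       edgeOf ab ≡ edgeOf a′b′ → a ≡ a′ × b ≡ b′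
    edgeOf-injective _ _ (inj₁ (_ , a→b)) (inj₁ (_ , a′→b′)) refl = same-parent a→b a′→b′
    edgeOf-injective _ _ (inj₂ (_ , b→a)) (inj₂ (_ , b′→a′)) refl = swap (same-parent b→a b′→a′)
    edgeOf-injective a<b a′<b′ (inj₁ (_ , a→b)) (inj₂ (_ , b′→a′)) refl with refl , refl ← same-parent a→b b′→a′ =
      contradiction a<b (<ᶠ-asym a′<b′)
    edgeOf-injective a<b a′<b′ (inj₂ (_ , b→a)) (inj₁ (_ , a′→b′)) refl with refl , refl ← same-parent b→a a′→b′ =
      contradiction a<b (<ᶠ-asym a′<b′)

  module Extend {A : Fin (suc k) → Bool} {v : Fin (suc k)} (A-v : A v ≡ true) (C : PartialCopy (A - v))
                (w : Fin n) (S-w : S w ≡ true) (w-fresh : ∀ {a} → (A - v) a ≡ true → PartialCopy.φ C a ≢ w)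
                (l : Link)
                (l-valid : ∀ {u i} → l ≡ just (u , i) →
                           (A - v) u ≡ true × adj T v u ≡ true × w ∈ hedge H i × PartialCopy.φ C u ∈ hedge H i ×
                           ∀ {a b} → PartialCopy.link C a ≢ just (b , i))
                (l-covers : ∀ {c} → (A - v) c ≡ true → adj T v c ≡ true → ∃ λ i → l ≡ just (c , i)) where
    open PartialCopy C

    φ′ : Fin (suc k) → Fin n
    φ′ = updateAt φ v (λ _ → w)

    link′ : Fin (suc k) → Link
    link′ = updateAt link v (λ _ → l)

    φ′-new : φ′ v ≡ w
    φ′-new = updateAt-updates v φ

    φ′-old : ∀ {a} → a ≢ v → φ′ a ≡ φ a
    φ′-old a≢v = updateAt-minimal _ v φ a≢v

    link′-new : link′ v ≡ l
    link′-new = updateAt-updates v link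

    link′-old : ∀ {a} → a ≢ v → link′ a ≡ link a
    link′-old a≢v = updateAt-minimal _ v link a≢v

    v∉ : (A - v) v ≢ true
    v∉ A-v-v = proj₂ (x∈p-y⁻ {p = A} A-v-v) refl

    old : ∀ {a} → A a ≡ true → a ≢ v → (A - v) a ≡ true
    old = x∈p-y⁺ {p = A}

    old⇒∈A : ∀ {a} → (A - v) a ≡ true → A a ≡ true
    old⇒∈A = proj₁ ∘ x∈p-y⁻ {p = A}

    old⇒≢ : ∀ {a} → (A - v) a ≡ true → a ≢ v
    old⇒≢ = proj₂ ∘ x∈p-y⁻ {p = A}

    φ′-injective : ∀ {a b} → A a ≡ true → A b ≡ true → φ′ a ≡ φ′ b → a ≡ b
    φ′-injective {a} {b} A-a A-b eq with a ≟ v | b ≟ v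
    ... | yes refl | yes refl = refl
    ... | yes refl | no b≢v = contradiction (trans (sym (φ′-old b≢v)) (trans (sym eq) φ′-new)) (w-fresh (old A-b b≢v))
    ... | no a≢v | yes refl = contradiction (trans (sym (φ′-old a≢v)) (trans eq φ′-new)) (w-fresh (old A-a a≢v))
    ... | no a≢v | no b≢v = φ-injective (old A-a a≢v) (old A-b b≢v) (trans (sym (φ′-old a≢v)) (trans eq (φ′-old b≢v)))

    φ′∈S : ∀ {a} → A a ≡ true → S (φ′ a) ≡ true
    φ′∈S {a} A-a with a ≟ v
    ... | yes refl = subst (λ x → S x ≡ true) (sym φ′-new) S-w
    ... | no a≢v   = subst (λ x → S x ≡ true) (sym (φ′-old a≢v)) (φ∈S (old A-a a≢v))

    link′-cases : ∀ {a b i} → link′ a ≡ just (b , i) →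
                  (a ≡ v × l ≡ just (b , i)) ⊎ (a ≢ v × link a ≡ just (b , i))
    link′-cases {a} a→b with a ≟ v
    ... | yes refl = inj₁ (refl , trans (sym link′-new) a→b)
    ... | no  a≢v  = inj₂ (a≢v , trans (sym (link′-old a≢v)) a→b)

    l-unused : ∀ {u i} → l ≡ just (u , i) → ∀ {a b} → link a ≢ just (b , i)
    l-unused e = let _ , _ , _ , _ , unused = l-valid e in unused

    no-link-to-v : ∀ {a i} → link a ≢ just (v , i)
    no-link-to-v a→v = v∉ (parent∈A a→v)

    linked⇒≢v : ∀ {a b i} → link a ≡ just (b , i) → a ≢ v
    linked⇒≢v = old⇒≢ ∘ link⇒∈A

    link′⇒∈A : ∀ {a b i} → link′ a ≡ just (b , i) → A a ≡ true
    link′⇒∈A a→b with link′-cases a→b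
    ... | inj₁ (refl , _) = A-v
    ... | inj₂ (_ , e)    = old⇒∈A (link⇒∈A e)

    parent′∈A : ∀ {a b i} → link′ a ≡ just (b , i) → A b ≡ true
    parent′∈A a→b with link′-cases a→b
    ... | inj₁ (refl , e) = old⇒∈A (proj₁ (l-valid e))
    ... | inj₂ (_ , e)    = old⇒∈A (parent∈A e)

    parent′-adj : ∀ {a b i} → link′ a ≡ just (b , i) → adj T a b ≡ true
    parent′-adj a→b with link′-cases a→b
    ... | inj₁ (refl , e) = proj₁ (proj₂ (l-valid e))
    ... | inj₂ (_ , e)    = parent-adj e

    no-mutual-parents′ : ∀ {a b i j} → link′ a ≡ just (b , i) → link′ b ≢ just (a , j)
    no-mutual-parents′ a→b b→a with link′-cases a→b | link′-cases b→a
    ... | inj₁ (refl , e) | inj₁ (refl , _) = old⇒≢ (proj₁ (l-valid e)) refl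
    ... | inj₁ (refl , _) | inj₂ (_ , e′)   = no-link-to-v e′
    ... | inj₂ (_ , e)    | inj₁ (refl , _) = no-link-to-v e
    ... | inj₂ (_ , e)    | inj₂ (_ , e′)   = no-mutual-parents e e′

    adj⇒linked′ : ∀ {a b} → A a ≡ true → A b ≡ true → adj T a b ≡ true →
                  (∃ λ i → link′ a ≡ just (b , i)) ⊎ (∃ λ i → link′ b ≡ just (a , i))
    adj⇒linked′ {a} {b} A-a A-b a-b with a ≟ v | b ≟ v
    ... | yes refl | yes refl = contradiction refl (adj⇒≢ T a-b)
    ... | yes refl | no b≢v   = let i , e = l-covers (old A-b b≢v) a-b in inj₁ (i , trans link′-new e)
    ... | no a≢v   | yes refl = let i , e = l-covers (old A-a a≢v) (trans (adj-sym T v a) a-b) in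
                                inj₂ (i , trans link′-new e)
    ... | no a≢v   | no b≢v with adj⇒linked (old A-a a≢v) (old A-b b≢v) a-b
    ...   | inj₁ (i , e) = inj₁ (i , trans (link′-old a≢v) e)
    ...   | inj₂ (i , e) = inj₂ (i , trans (link′-old b≢v) e)

    hyperedge′-injective : ∀ {a a′ b b′ i} → link′ a ≡ just (b , i) → link′ a′ ≡ just (b′ , i) → a ≡ a′
    hyperedge′-injective a→b a′→b′ with link′-cases a→b | link′-cases a′→b′
    ... | inj₁ (refl , _) | inj₁ (refl , _)  = refl
    ... | inj₁ (refl , e) | inj₂ (_ , e′)    = contradiction e′ (l-unused e)
    ... | inj₂ (_ , e)    | inj₁ (refl , e′) = contradiction e (l-unused e′)
    ... | inj₂ (_ , e)    | inj₂ (_ , e′)    = hyperedge-injective e e′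

    hyperedge′-contains : ∀ {a b i} → link′ a ≡ just (b , i) → φ′ a ∈ hedge H i × φ′ b ∈ hedge H i
    hyperedge′-contains {b = b} {i} a→b with link′-cases a→b
    ... | inj₁ (refl , e) = let A-b , _ , w∈i , φb∈i , _ = l-valid e in
      subst (_∈ hedge H i) (sym φ′-new) w∈i , subst (_∈ hedge H i) (sym (φ′-old (old⇒≢ A-b))) φb∈i
    ... | inj₂ (a≢v , e) = let φa∈i , φb∈i = hyperedge-contains e in
      subst (_∈ hedge H i) (sym (φ′-old a≢v)) φa∈i , subst (_∈ hedge H i) (sym (φ′-old (old⇒≢ (parent∈A e)))) φb∈i

    #links′≤ : count (is-just ∘ link′) ≤ count A ∸ 1
    #links′≤ = begin
      count (is-just ∘ link′)                            ≡⟨ count-cong (map-updateAt {f = is-just} (λ _ → refl) link v) ⟩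
      count (updateAt (is-just ∘ link) v (λ _ → is-just l)) ≡⟨ count-updateAt (is-just ∘ link) v (is-just l) v-unlinked ⟩
      ⟦ is-just l ⟧ + count (is-just ∘ link)             ≤⟨ +-monoʳ-≤ ⟦ is-just l ⟧ #links≤ ⟩
      ⟦ is-just l ⟧ + (count (A - v) ∸ 1)                ≤⟨ room l refl ⟩
      count (A - v)                                      ≡⟨ count-remove-∸ A v A-v ⟩
      count A ∸ 1                                        ∎
      where
      open ≤-Reasoning
      v-unlinked : is-just (link v) ≡ false
      v-unlinked with link v in e
      ... | just _  = contradiction refl (linked⇒≢v e)
      ... | nothing = refl
      room : ∀ l′ → l ≡ l′ → ⟦ is-just l′ ⟧ + (count (A - v) ∸ 1) ≤ count (A - v)
      room nothing  _ = m∸n≤m _ 1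
      room (just _) e = ≤-reflexive (m+[n∸m]≡n (x∈p⇒0<count (A - v) (proj₁ (l-valid e))))

    copy : PartialCopy A
    copy = record
      { φ = φ′ ; φ-injective = φ′-injective ; φ∈S = φ′∈S ; link = link′
      ; link⇒∈A = link′⇒∈A ; parent∈A = parent′∈A ; parent-adj = parent′-adj
      ; no-mutual-parents = no-mutual-parents′ ; adj⇒linked = adj⇒linked′
      ; hyperedge-injective = hyperedge′-injective ; hyperedge-contains = hyperedge′-contains ; #links≤ = #links′≤ }

  record Attachment {A′ : Fin (suc k) → Bool} (C : PartialCopy A′) (u : Fin (suc k)) : Set where
    field
      w        : Fin n
      i        : HEdge H
      w∈S      : S w ≡ true
      w-fresh  : ∀ {a} → A′ a ≡ true → PartialCopy.φ C a ≢ w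
      w∈i      : w ∈ hedge H i
      φu∈i     : PartialCopy.φ C u ∈ hedge H i
      i-unused : ∀ {a b} → PartialCopy.link C a ≢ just (b , i)

  module Attach {A′ : Fin (suc k) → Bool} (C : PartialCopy A′) (u : Fin (suc k)) (A′-u : A′ u ≡ true) where
    open PartialCopy C

    x : Fin n
    x = φ u

    E : HEdge H → Fin n → Bool
    E i = lookup (hedge H i)

    ∈⇒E : ∀ {y i} → y ∈ hedge H i → E i y ≡ true
    ∈⇒E = []=⇒lookup

    image : Fin (suc k) → Fin n → Bool
    image a y = (A′ - u) a ∧ does (y ≟ φ a)

    rest : Fin (suc k) → Link → Fin n → Bool
    rest a nothing        y = false
    rest a (just (b , i)) y = E i x ∧ (E i - φ a - φ b - x) y

    incident : Fin (suc k) → Link → Bool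
    incident a nothing        = false
    incident a (just (b , _)) = does (a ≟ u) ∨ does (b ≟ u)

    edge-size : ∀ i → count (E i) ≡ r
    edge-size i = trans (sym (∣p∣≡count (hedge H i))) (All.lookup (uniform H) (∈-lookup i))

    rest-size : ∀ {a b i} → link a ≡ just (b , i) → count (E i - φ a - φ b) ≡ r ∸ 1 ∸ 1
    rest-size {a} {b} {i} a→b = begin
      count (E i - φ a - φ b) ≡⟨ count-remove-∸ (E i - φ a) (φ b) (x∈p-y⁺ {p = E i} φb∈i φb≢φa) ⟩
      count (E i - φ a) ∸ 1   ≡⟨ cong (_∸ 1) (count-remove-∸ (E i) (φ a) φa∈i) ⟩
      count (E i) ∸ 1 ∸ 1     ≡⟨ cong (λ c → c ∸ 1 ∸ 1) (edge-size i) ⟩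
      r ∸ 1 ∸ 1               ∎
      where
      open ≡-Reasoning
      φa∈i = ∈⇒E (proj₁ (hyperedge-contains a→b))
      φb∈i = ∈⇒E (proj₂ (hyperedge-contains a→b))
      φb≢φa : φ b ≢ φ a
      φb≢φa eq = adj⇒≢ T (parent-adj a→b) (sym (φ-injective (parent∈A a→b) (link⇒∈A a→b) eq))

    x∈rest : ∀ {a b i} → link a ≡ just (b , i) → E i x ≡ true → a ≢ u → b ≢ u → (E i - φ a - φ b) x ≡ true
    x∈rest {a} {b} {i} a→b x∈i a≢u b≢u =
      x∈p-y⁺ {p = E i - φ a} (x∈p-y⁺ {p = E i} x∈i (a≢u ∘ sym ∘ φ-injective A′-u (link⇒∈A a→b)))
                             (b≢u ∘ sym ∘ φ-injective A′-u (parent∈A a→b))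

    -- A used hyperedge loses the two ends of its tree edge and x, leaving r − 3 vertices,
    -- unless the tree edge is incident to u: then x is one of its ends and r − 2 remain.
    rest-count : ∀ a → count (rest a (link a)) ≤ ⟦ is-just (link a) ⟧ * (r ∸ 3) + ⟦ incident a (link a) ⟧
    rest-count a with link a in a→b
    ... | nothing = ≤-reflexive (count-false n)
    ... | just (b , i) with E i x in x∈i
    ...   | false = ≤-trans (≤-reflexive (count-false n)) z≤n
    ...   | true with a ≟ u | b ≟ u
    ...     | no a≢u | no b≢u = begin
      count (E i - φ a - φ b - x) ≡⟨ count-remove-∸ (E i - φ a - φ b) x (x∈rest a→b x∈i a≢u b≢u) ⟩
      count (E i - φ a - φ b) ∸ 1 ≡⟨ cong (_∸ 1) (rest-size a→b) ⟩
      r ∸ 1 ∸ 1 ∸ 1               ≤⟨ r∸1∸1∸1≤ r ⟩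
      1 * (r ∸ 3) + 0             ∎
      where open ≤-Reasoning
    ...     | yes _  | _      = ≤-trans (count-remove-≤ _ x) (≤-trans (≤-reflexive (rest-size a→b)) (r∸1∸1≤ r))
    ...     | no _   | yes _  = ≤-trans (count-remove-≤ _ x) (≤-trans (≤-reflexive (rest-size a→b)) (r∸1∸1≤ r))

    child : Fin (suc k) → Bool
    child a with link a
    ... | nothing      = false
    ... | just (b , _) = does (b ≟ u)

    child⇒ : ∀ {a} → child a ≡ true → ∃ λ i → link a ≡ just (u , i)
    child⇒ {a} c with link a
    child⇒ {a} () | nothing
    child⇒ {a} c  | just (b , i) with b ≟ u
    ... | yes refl = i , refl

    incident≤ : ∀ a → ⟦ incident a (link a) ⟧ ≤ ⟦ is-just (link u) ∧ does (a ≟ u) ⟧ + ⟦ child a ⟧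
    incident≤ a with link a in a→b
    ... | nothing = z≤n
    ... | just _ with a ≟ u
    ...   | yes refl rewrite a→b = s≤s z≤n
    ...   | no _ rewrite ∧-zeroʳ (is-just (link u)) = ≤-refl

    N : Fin (suc k) → Bool
    N a = A′ a ∧ adj T u a

    child⇒N : ∀ a → child a ≡ true → N a ≡ true
    child⇒N a c with i , a→u ← child⇒ c = cong₂ _∧_ (link⇒∈A a→u) (trans (adj-sym T u a) (parent-adj a→u))

    children-count : ⟦ is-just (link u) ⟧ + count child ≤ count N
    children-count with link u in u→p
    ... | nothing = count-mono child⇒N
    ... | just (p , j) = begin
      suc (count child)   ≤⟨ s≤s (count-mono child⇒N-p) ⟩
      suc (count (N - p)) ≡⟨ sym (count-remove N p (cong₂ _∧_ (parent∈A u→p) (parent-adj u→p))) ⟩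
      count N             ∎
      where
      open ≤-Reasoning
      child⇒N-p : ∀ a → child a ≡ true → (N - p) a ≡ true
      child⇒N-p a c = x∈p-y⁺ {p = N} (child⇒N a c) λ where refl → no-mutual-parents u→p (proj₂ (child⇒ c))

    incident-count : count (λ a → incident a (link a)) ≤ count N
    incident-count = begin
      count (λ a → incident a (link a))                            ≤⟨ count-≤-+ incident≤ ⟩
      count (λ a → is-just (link u) ∧ does (a ≟ u)) + count child ≡⟨ cong (_+ count child) (count-singleton _ u) ⟩
      ⟦ is-just (link u) ⟧ + count child                          ≤⟨ children-count ⟩
      count N                                                     ∎
      where open ≤-Reasoning

    blocked : Fin (suc k) → Fin n → Bool
    blocked a y = image a y ∨ rest a (link a) y

    blocked-count : sum (λ a → count (blocked a)) ≤ (count A′ ∸ 1) + ((r ∸ 3) * (count A′ ∸ 1) + count N)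
    blocked-count = begin
      sum (λ a → count (blocked a))
        ≤⟨ ∑-mono-≤ (λ a → count-∨ (image a) (rest a (link a))) ⟩
      sum (λ a → count (image a) + count (rest a (link a)))
        ≡⟨ ∑-distrib-+ (λ a → count (image a)) (λ a → count (rest a (link a))) ⟩
      sum (λ a → count (image a)) + sum (λ a → count (rest a (link a)))
        ≤⟨ +-mono-≤ (≤-reflexive images) rests ⟩
      (count A′ ∸ 1) + ((r ∸ 3) * (count A′ ∸ 1) + count N) ∎
      where
      open ≤-Reasoning
      images : sum (λ a → count (image a)) ≡ count A′ ∸ 1
      images = trans (count-image (A′ - u) φ) (count-remove-∸ A′ u A′-u)
      rests : sum (λ a → count (rest a (link a))) ≤ (r ∸ 3) * (count A′ ∸ 1) + count N
      rests = begin
        sum (λ a → count (rest a (link a)))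
          ≤⟨ ∑-mono-≤ rest-count ⟩
        sum (λ a → ⟦ is-just (link a) ⟧ * (r ∸ 3) + ⟦ incident a (link a) ⟧)
          ≡⟨ ∑-distrib-+ (λ a → ⟦ is-just (link a) ⟧ * (r ∸ 3)) (λ a → ⟦ incident a (link a) ⟧) ⟩
        sum (λ a → ⟦ is-just (link a) ⟧ * (r ∸ 3)) + sum (λ a → ⟦ incident a (link a) ⟧)
          ≡⟨ cong₂ _+_ (sym (*-distribʳ-sum (r ∸ 3) (λ a → ⟦ is-just (link a) ⟧))) (sym (count≡∑ _)) ⟩
        sum (λ a → ⟦ is-just (link a) ⟧) * (r ∸ 3) + count (λ a → incident a (link a))
          ≡⟨ cong (λ c → c * (r ∸ 3) + count (λ a → incident a (link a))) (sym (count≡∑ (is-just ∘ link))) ⟩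
        count (is-just ∘ link) * (r ∸ 3) + count (λ a → incident a (link a))
          ≤⟨ +-mono-≤ (*-monoˡ-≤ (r ∸ 3) #links≤) incident-count ⟩
        (count A′ ∸ 1) * (r ∸ 3) + count N
          ≡⟨ cong (_+ count N) (*-comm (count A′ ∸ 1) (r ∸ 3)) ⟩
        (r ∸ 3) * (count A′ ∸ 1) + count N ∎

    attach : (count A′ ∸ 1) + ((r ∸ 3) * (count A′ ∸ 1) + count N) < count (λ y → S y ∧ adj (shadow H) x y) →
             Attachment C u
    attach room with pigeonhole-∑ _ blocked (≤-<-trans blocked-count room)
    ... | w , S∩N-w , unblocked with adj⇒Shadow H (∧-conicalʳ (S w) _ S∩N-w)
    ...   | x≢w , i , x∈i , w∈i = record
      { w = w ; i = i ; w∈S = ∧-conicalˡ _ _ S∩N-w ; w-fresh = fresh ; w∈i = w∈i ; φu∈i = x∈i ; i-unused = unused }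
      where
      fresh : ∀ {a} → A′ a ≡ true → φ a ≢ w
      fresh {a} A′-a φa≡w with a ≟ u
      ... | yes refl = x≢w φa≡w
      ... | no  a≢u
        with () ← trans (sym (cong₂ _∧_ (x∈p-y⁺ {p = A′} A′-a a≢u) (dec-true (w ≟ φ a) (sym φa≡w))))
                        (∨-conicalˡ _ _ (unblocked a))

      rest-w : ∀ {a b} → link a ≡ just (b , i) → rest a (link a) w ≡ true
      rest-w {a} {b} a→b rewrite a→b = cong₂ _∧_ (∈⇒E x∈i)
        (x∈p-y⁺ {p = E i - φ a - φ b}
          (x∈p-y⁺ {p = E i - φ a} (x∈p-y⁺ {p = E i} (∈⇒E w∈i) (fresh (link⇒∈A a→b) ∘ sym)) (fresh (parent∈A a→b) ∘ sym))
          (x≢w ∘ sym))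

      unused : ∀ {a b} → link a ≢ just (b , i)
      unused {a} a→b with () ← trans (sym (rest-w a→b)) (∨-conicalʳ _ _ (unblocked a))

room-arithmetic : ∀ {j k c d e} → 1 ≤ j → j ≤ k → d ≤ e → (j ∸ 1) + (c * (j ∸ 1) + d) < k + c * (k ∸ 1) + e
room-arithmetic {suc j} {k} {c} {d} {e} _ j<k d≤e = begin-strict
  j + (c * j + d)             <⟨ +-mono-<-≤ j<k (+-mono-≤ (*-monoʳ-≤ c (∸-monoˡ-≤ 1 j<k)) d≤e) ⟩
  k + (c * (k ∸ 1) + e)       ≡⟨ sym (+-assoc k _ e) ⟩
  k + c * (k ∸ 1) + e         ∎
  where open ≤-Reasoning

module _ {r n k Δ m : ℕ} (T : Graph (suc k)) (H : UniformHypergraph r n)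
         (acyclic : IsForest T) (degree≤Δ : ∀ u → degree T u ≤ Δ)
         (large : k + (r ∸ 3) * (k ∸ 1) + (Δ ∸ 1) ≤ m)
         (S : Fin n → Bool) (x₀ : Fin n) (S-x₀ : S x₀ ≡ true) (dense : InducedMinDegree (shadow H) S m) where
  open PartialCopies T H S

  m<|S| : m < count S
  m<|S| = begin-strict
    m                                      ≤⟨ dense x₀ S-x₀ ⟩
    count (λ y → S y ∧ adj (shadow H) x₀ y) ≤⟨ count-mono neighbour⇒ ⟩
    count (S - x₀)                          <⟨ ≤-reflexive (sym (count-remove S x₀ S-x₀)) ⟩
    count S                                 ∎
    where
    open ≤-Reasoning
    neighbour⇒ : ∀ y → S y ∧ adj (shadow H) x₀ y ≡ true → (S - x₀) y ≡ true
    neighbour⇒ y q = x∈p-y⁺ {p = S} (∧-conicalˡ _ _ q) (adj⇒≢ (shadow H) (∧-conicalʳ (S y) _ q) ∘ sym)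

  k≤m : k ≤ m
  k≤m = ≤-trans (≤-trans (m≤m+n k _) (m≤m+n _ _)) large

  count-remove≤k : ∀ {A : Fin (suc k) → Bool} {v} → A v ≡ true → count (A - v) ≤ k
  count-remove≤k {A} {v} A-v = ≤-trans (≤-reflexive (count-remove-∸ A v A-v)) (∸-monoˡ-≤ 1 (count≤n A))

  attach-room : ∀ {A v u} (C : PartialCopy (A - v)) → A v ≡ true → (A - v) u ≡ true → adj T v u ≡ true →
                (count (A - v) ∸ 1) + ((r ∸ 3) * (count (A - v) ∸ 1) + count (λ a → (A - v) a ∧ adj T u a))
                  < count (λ y → S y ∧ adj (shadow H) (PartialCopy.φ C u) y)
  attach-room {A} {v} {u} C A-v A′-u v-u = begin-strict
    (count (A - v) ∸ 1) + ((r ∸ 3) * (count (A - v) ∸ 1) + count (λ a → (A - v) a ∧ adj T u a))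
      <⟨ room-arithmetic {c = r ∸ 3} (x∈p⇒0<count (A - v) A′-u) (count-remove≤k A-v) neighbours ⟩
    k + (r ∸ 3) * (k ∸ 1) + (Δ ∸ 1)
      ≤⟨ large ⟩
    m
      ≤⟨ dense (φ u) (φ∈S A′-u) ⟩
    count (λ y → S y ∧ adj (shadow H) (φ u) y) ∎
    where
    open ≤-Reasoning
    open PartialCopy C
    neighbours : count (λ a → (A - v) a ∧ adj T u a) ≤ Δ ∸ 1
    neighbours = begin
      count (λ a → (A - v) a ∧ adj T u a) ≤⟨ count-mono (λ a q → x∈p-y⁺ {p = adj T u} (∧-conicalʳ ((A - v) a) _ q)
                                                                 (proj₂ (x∈p-y⁻ {p = A} (∧-conicalˡ _ _ q)))) ⟩
      count (adj T u - v)                 ≡⟨ count-remove-∸ (adj T u) v (trans (adj-sym T u v) v-u) ⟩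
      count (adj T u) ∸ 1                 ≤⟨ ∸-monoˡ-≤ 1 (subst (_≤ Δ) (degree≡count T u) (degree≤Δ u)) ⟩
      Δ ∸ 1                               ∎

  addLeaf : ∀ {A} v → A v ≡ true → LeafIn T A v → PartialCopy (A - v) → PartialCopy A
  addLeaf {A} v A-v leaf C with any? (λ u → ((A - v) u ≟ᵇ true) ×-dec (adj T v u ≟ᵇ true))
  ... | yes (u , A′-u , v-u) = attachLeaf (Attach.attach C u A′-u (attach-room C A-v A′-u v-u))
    where
    attachLeaf : Attachment C u → PartialCopy A
    attachLeaf a =
      Extend.copy A-v C w w∈S w-fresh (just (u , i)) (λ where refl → A′-u , v-u , w∈i , φu∈i , i-unused) covers
      where
      open Attachment a
      covers : ∀ {c} → (A - v) c ≡ true → adj T v c ≡ true → ∃ λ i′ → just (u , i) ≡ just (c , i′)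
      covers A′-c v-c with refl ← leaf (proj₁ (x∈p-y⁻ {p = A} A′-u)) (proj₁ (x∈p-y⁻ {p = A} A′-c)) v-u v-c =
        i , refl
  ... | no isolated =
    let w , S-w , fresh = pigeonhole-image S (A - v) (PartialCopy.φ C)
                            (≤-<-trans (≤-trans (count-remove≤k A-v) k≤m) m<|S|)
    in Extend.copy A-v C w S-w (fresh _) nothing (λ ()) λ A′-c v-c → contradiction (_ , A′-c , v-c) isolated

  build : ∀ j (A : Fin (suc k) → Bool) → count A ≡ j → PartialCopy A
  build zero    A empty = emptyCopy A empty x₀
  build (suc j) A size =
    let v , A-v , leaf = forest-leaf T acyclic A (0<count⇒∃ A (subst (0 <_) (sym size) (s≤s z≤n)))
    in addLeaf v A-v leaf (build j (A - v) (trans (count-remove-∸ A v A-v) (cong (_∸ 1) size)))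

  denseShadow⇒bergeCopy : BergeCopy T H
  denseShadow⇒bergeCopy = toBergeCopy (build (suc k) (λ _ → true) (count-true (suc k)))

theorem1p5 : (r k Δ : ℕ) → 3 ≤ r → (T : Graph (suc k)) → IsForest T →
    MaxDegree T Δ → 1 ≤ Δ →
    (n : ℕ) (H : UniformHypergraph r n) → BergeFree T H →
    StrongChromatic≤ H (k + (r ∸ 3) * (k ∸ 1) + Δ ∸ 1)
theorem1p5 r k Δ _ T acyclic (degree≤Δ , _) 1≤Δ n H free
  rewrite +-∸-assoc (k + (r ∸ 3) * (k ∸ 1)) 1≤Δ
  with dense-or-colourable (shadow H) (k + (r ∸ 3) * (k ∸ 1) + (Δ ∸ 1))
... | inj₁ (S , (x₀ , S-x₀) , dense) =
  contradiction (denseShadow⇒bergeCopy T H acyclic degree≤Δ ≤-refl S x₀ S-x₀ dense) free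
... | inj₂ (c , proper) = c , properColouring⇒strong H proper
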